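{- Let $F$ be an abelian group and $\gamma_1,\gamma_2,\gamma_3\in F$ with $\gamma_1\gamma_2=\gamma_3$, where $\gamma_1,\gamma_2$ have finite orders $m=|\gamma_1|$, $n=|\gamma_2|$. Suppose $r=|\gamma_3|=p^\alpha$ with $p$ prime and $\alpha$ a positive integer. Let $k=v_p(m)$ and assume $v_p(m)\le v_p(n)$. Then $n=m$ if $v_p(m)\ge\alpha$, and $n=p^{\alpha-k}m$ if $v_p(m)<\alpha$.
   Context: $|\gamma|$ denotes the order of $\gamma$. $v_p(x)$ is the $p$-adic valuation of the positive integer $x$. -}

module Defs where

open import Level using (Level)
open import Algebra.Bundles using (AbelianGroup)
open import Data.Nat using (ℕ; suc; _<_; _^_)
open import Data.Nat.Divisibility using (_∣_)
open import Data.Product using (_×_)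
open import Relation.Nullary using (¬_)

module _ {c ℓ : Level} (G : AbelianGroup c ℓ) where
  open AbelianGroup G
  open import Algebra.Definitions.RawMonoid rawMonoid renaming (_×_ to _·×_)

  pow : Carrier → ℕ → Carrier
  pow g n = n ·× g

  HasOrder : Carrier → ℕ → Set ℓ
  HasOrder g m = (0 < m) × (pow g m ≈ ε) × (∀ j → 0 < j → j < m → ¬ (pow g j ≈ ε))

IsVal : ℕ → ℕ → ℕ → Set
IsVal p x k = (p ^ k ∣ x) × ¬ (p ^ suc k ∣ x)

module Submission where

open import Defs
open import Level using (Level)
open import Algebra.Bundles using (AbelianGroup)
open import Data.Nat using (ℕ; zero; suc; _≤_; _<_; _^_; _+_; _*_; _∸_; _⊔_; z<s; >-nonZero)
open import Data.Nat.Primality using (Prime; prime⇒irreducible; prime⇒nonZero)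
open import Data.Product using (_×_; _,_; proj₁; proj₂; ∃-syntax)
open import Relation.Binary.PropositionalEquality using (_≡_)
open import Data.Nat.Properties
open import Data.Nat.Divisibility
open import Data.Nat.DivMod using (_%_; _/_; m≡m%n+[m/n]*n; m%n<n)
open import Data.Nat.LCM using (lcm; m∣lcm[m,n]; n∣lcm[m,n]; lcm-least)
open import Data.Nat.Coprimality using (Coprime; coprime-divisor)
open import Algebra.Properties.CommutativeSemigroup *-commutativeSemigroup using (x∙yz≈y∙xz)
open import Data.Sum using (inj₁; inj₂)
open import Data.Empty using (⊥-elim)
open import Relation.Nullary using (¬_)
import Relation.Binary.PropositionalEquality as ≡

-- Since any two of γ₁, γ₂, γ₁ γ₂ determine the third, their orders m, n and p^α
-- satisfy m ∣ lcm n p^α, n ∣ lcm m p^α and p^α ∣ lcm m n.  The first two force m and n to have the same prime-to-p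
-- part u; writing m = u p^k and n = u p^l, the last two then pin down
-- l = max k α, which is the claim.

module _ {c ℓ : Level} (G : AbelianGroup c ℓ) where
  open AbelianGroup G
  open import Algebra.Properties.Monoid.Mult monoid using (×-homo-+; ×-assocˡ; ×-congʳ; ×-congˡ)
  open import Algebra.Properties.CommutativeMonoid.Mult commutativeMonoid using (×-distrib-+)
  open import Relation.Binary.Reasoning.Setoid setoid

  pow-ε : ∀ j → pow G ε j ≈ ε
  pow-ε zero    = refl
  pow-ε (suc j) = trans (identityˡ _) (pow-ε j)

  ∣⇒pow≈ε : ∀ {g m j} → pow G g m ≈ ε → m ∣ j → pow G g j ≈ ε
  ∣⇒pow≈ε {g} {m} gᵐ≈ε (divides q ≡.refl) = begin
    pow G g (q * m)          ≈⟨ ×-assocˡ g q m ⟨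
    pow G (pow G g m) q      ≈⟨ ×-congʳ q gᵐ≈ε ⟩
    pow G ε q                ≈⟨ pow-ε q ⟩
    ε                        ∎

  HasOrder⇒∣ : ∀ {g m j} → HasOrder G g m → pow G g j ≈ ε → m ∣ j
  HasOrder⇒∣ {g} {m} {j} (m>0 , gᵐ≈ε , minimal) gʲ≈ε = m%n≡0⇒n∣m j m remainder≡0
    where
    instance
      m≢0 = >-nonZero m>0

    pow-remainder : pow G g (j % m) ≈ ε
    pow-remainder = begin
      pow G g (j % m)                        ≈⟨ identityʳ _ ⟨
      pow G g (j % m) ∙ ε                    ≈⟨ ∙-congˡ (∣⇒pow≈ε gᵐ≈ε (n∣m*n (j / m))) ⟨
      pow G g (j % m) ∙ pow G g (j / m * m)  ≈⟨ ×-homo-+ g (j % m) (j / m * m) ⟨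
      pow G g (j % m + j / m * m)            ≈⟨ ×-congˡ (m≡m%n+[m/n]*n j m) ⟨
      pow G g j                              ≈⟨ gʲ≈ε ⟩
      ε                                      ∎

    remainder≡0 : j % m ≡ 0
    remainder≡0 with j % m | m%n<n j m | pow-remainder
    ... | zero  | _   | _ = ≡.refl
    ... | suc r | r<m | e = ⊥-elim (minimal (suc r) z<s r<m e)

  module _ {x y z : Carrier} {a b c : ℕ} (xy≈z : x ∙ y ≈ z)
           (oˣ : HasOrder G x a) (oʸ : HasOrder G y b) (oᶻ : HasOrder G z c) where

    order-∙-∣-lcm : c ∣ lcm a b
    order-∙-∣-lcm = HasOrder⇒∣ oᶻ (begin
      pow G z (lcm a b)                      ≈⟨ ×-congʳ (lcm a b) xy≈z ⟨
      pow G (x ∙ y) (lcm a b)                ≈⟨ ×-distrib-+ x y (lcm a b) ⟩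
      pow G x (lcm a b) ∙ pow G y (lcm a b)  ≈⟨ ∙-cong (∣⇒pow≈ε (proj₁ (proj₂ oˣ)) (m∣lcm[m,n] a b))
                                                       (∣⇒pow≈ε (proj₁ (proj₂ oʸ)) (n∣lcm[m,n] a b)) ⟩
      ε ∙ ε                                  ≈⟨ identityˡ ε ⟩
      ε                                      ∎)

    order-∙-cancelˡ-∣-lcm : b ∣ lcm a c
    order-∙-cancelˡ-∣-lcm = HasOrder⇒∣ oʸ (begin
      pow G y (lcm a c)                      ≈⟨ identityˡ _ ⟨
      ε ∙ pow G y (lcm a c)                  ≈⟨ ∙-congʳ (∣⇒pow≈ε (proj₁ (proj₂ oˣ)) (m∣lcm[m,n] a c)) ⟨
      pow G x (lcm a c) ∙ pow G y (lcm a c)  ≈⟨ ×-distrib-+ x y (lcm a c) ⟨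
      pow G (x ∙ y) (lcm a c)                ≈⟨ ×-congʳ (lcm a c) xy≈z ⟩
      pow G z (lcm a c)                      ≈⟨ ∣⇒pow≈ε (proj₁ (proj₂ oᶻ)) (n∣lcm[m,n] a c) ⟩
      ε                                      ∎)

^-monoʳ-∣ : ∀ p {a b} → a ≤ b → p ^ a ∣ p ^ b
^-monoʳ-∣ p {a} {b} a≤b = divides (p ^ (b ∸ a))
  (≡.trans (≡.cong (p ^_) (≡.sym (m∸n+n≡m a≤b))) (^-distribˡ-+-* p (b ∸ a) a))

IsVal⇒cofactor : ∀ {p x k} → IsVal p x k → ∃[ u ] x ≡ u * p ^ k × ¬ p ∣ u
IsVal⇒cofactor {p} {x} {k} (divides u x≡u*pᵏ , pᵏ⁺¹∤x) = u , x≡u*pᵏ , p∤u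
  where
  p∤u : ¬ p ∣ u
  p∤u (divides r u≡r*p) = pᵏ⁺¹∤x (divides r (begin
    x                ≡⟨ x≡u*pᵏ ⟩
    u * p ^ k        ≡⟨ ≡.cong (_* p ^ k) u≡r*p ⟩
    r * p * p ^ k    ≡⟨ *-assoc r p (p ^ k) ⟩
    r * p ^ suc k    ∎))
    where open ≡.≡-Reasoning

lcm-∣-*^ : ∀ v p {l α e} → l ≤ e → α ≤ e → lcm (v * p ^ l) (p ^ α) ∣ v * p ^ e
lcm-∣-*^ v p l≤e α≤e =
  lcm-least (*-monoʳ-∣ v (^-monoʳ-∣ p l≤e)) (∣-trans (^-monoʳ-∣ p α≤e) (n∣m*n v))

module _ {p : ℕ} (p-prime : Prime p) where

  ∤⇒coprime : ∀ {u} → ¬ p ∣ u → Coprime u p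
  ∤⇒coprime p∤u (d∣u , d∣p) with prime⇒irreducible p-prime d∣p
  ... | inj₁ d≡1     = d≡1
  ... | inj₂ ≡.refl = ⊥-elim (p∤u d∣u)

  ∣*p^⇒∣ : ∀ {u y} → ¬ p ∣ u → ∀ a → u ∣ y * p ^ a → u ∣ y
  ∣*p^⇒∣ {u} {y} p∤u zero    u∣y*1 = ≡.subst (u ∣_) (*-identityʳ y) u∣y*1
  ∣*p^⇒∣ {u} {y} p∤u (suc a) u∣y*pᵃ⁺¹ = ∣*p^⇒∣ p∤u a
    (coprime-divisor (∤⇒coprime p∤u) (≡.subst (u ∣_) (x∙yz≈y∙xz y p (p ^ a)) u∣y*pᵃ⁺¹))

  ^∣*^⇒≤ : ∀ {u a b} → ¬ p ∣ u → p ^ a ∣ u * p ^ b → a ≤ b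
  ^∣*^⇒≤ {u} {a} {b} p∤u pᵃ∣u*pᵇ = ≮⇒≥ λ b<a →
    p∤u (*-cancelʳ-∣ (p ^ b) {{m^n≢0 p b {{prime⇒nonZero p-prime}}}}
      (∣-trans (^-monoʳ-∣ p b<a) pᵃ∣u*pᵇ))

  cofactor-∣ : ∀ {u v} k l α → ¬ p ∣ u → u * p ^ k ∣ lcm (v * p ^ l) (p ^ α) → u ∣ v
  cofactor-∣ {u} {v} k l α p∤u u*pᵏ∣lcm = ∣*p^⇒∣ p∤u (l ⊔ α)
    (∣-trans (m∣m*n (p ^ k)) (∣-trans u*pᵏ∣lcm (lcm-∣-*^ v p (m≤m⊔n l α) (m≤n⊔m l α))))

  exponent≡⊔ : ∀ {u k l α} → ¬ p ∣ u → k ≤ l →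
               u * p ^ l ∣ lcm (u * p ^ k) (p ^ α) → p ^ α ∣ lcm (u * p ^ k) (u * p ^ l) →
               l ≡ k ⊔ α
  exponent≡⊔ {u} {k} {l} {α} p∤u k≤l u*pˡ∣lcm pᵅ∣lcm = ≤-antisym l≤k⊔α (⊔-lub k≤l α≤l)
    where
    α≤l : α ≤ l
    α≤l = ^∣*^⇒≤ p∤u (∣-trans pᵅ∣lcm (lcm-least (*-monoʳ-∣ u (^-monoʳ-∣ p k≤l)) ∣-refl))

    l≤k⊔α : l ≤ k ⊔ α
    l≤k⊔α = ^∣*^⇒≤ p∤u
      (∣-trans (n∣m*n u) (∣-trans u*pˡ∣lcm (lcm-∣-*^ u p (m≤m⊔n k α) (m≤n⊔m k α))))

  orders-of-product : ∀ {m n α k l} → IsVal p m k → IsVal p n l → k ≤ l →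
                      m ∣ lcm n (p ^ α) → n ∣ lcm m (p ^ α) → p ^ α ∣ lcm m n →
                      (α ≤ k → n ≡ m) × (k < α → n ≡ p ^ (α ∸ k) * m)
  orders-of-product {α = α} {k} {l} vm vn k≤l m∣lcm n∣lcm pᵅ∣lcm
    with IsVal⇒cofactor {p} {k = k} vm | IsVal⇒cofactor {p} {k = l} vn
  ... | u , ≡.refl , p∤u | v , ≡.refl , p∤v
    with ∣-antisym (cofactor-∣ k l α p∤u m∣lcm) (cofactor-∣ l k α p∤v n∣lcm)
  ... | ≡.refl with exponent≡⊔ {α = α} p∤u k≤l n∣lcm pᵅ∣lcm
  ... | ≡.refl = (λ α≤k → ≡.cong (λ e → u * p ^ e) (m≥n⇒m⊔n≡m α≤k)) , λ k<α → begin
    u * p ^ (k ⊔ α)              ≡⟨ ≡.cong (λ e → u * p ^ e) (m≤n⇒m⊔n≡n (<⇒≤ k<α)) ⟩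
    u * p ^ α                    ≡⟨ ≡.cong (λ e → u * p ^ e) (m∸n+n≡m (<⇒≤ k<α)) ⟨
    u * p ^ (α ∸ k + k)          ≡⟨ ≡.cong (u *_) (^-distribˡ-+-* p (α ∸ k) k) ⟩
    u * (p ^ (α ∸ k) * p ^ k)    ≡⟨ x∙yz≈y∙xz u (p ^ (α ∸ k)) (p ^ k) ⟩
    p ^ (α ∸ k) * (u * p ^ k)    ∎
    where open ≡.≡-Reasoning

mainTheorem6 : ∀ {c ℓ : Level} (F : AbelianGroup c ℓ) →
    let open AbelianGroup F in
    (γ₁ γ₂ γ₃ : Carrier) → (γ₁ ∙ γ₂) ≈ γ₃ →
    (m n p α k l : ℕ) →
    HasOrder F γ₁ m → HasOrder F γ₂ n →
    Prime p → 0 < α → HasOrder F γ₃ (p ^ α) →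
    IsVal p m k → IsVal p n l → k ≤ l →
    (α ≤ k → n ≡ m) × (k < α → n ≡ p ^ (α ∸ k) * m)
mainTheorem6 F γ₁ γ₂ γ₃ γ₁γ₂≈γ₃ m n p α k l o₁ o₂ p-prime _ o₃ vm vn k≤l =
  orders-of-product p-prime vm vn k≤l
    (order-∙-cancelˡ-∣-lcm F γ₂γ₁≈γ₃ o₂ o₁ o₃)
    (order-∙-cancelˡ-∣-lcm F γ₁γ₂≈γ₃ o₁ o₂ o₃)
    (order-∙-∣-lcm F γ₁γ₂≈γ₃ o₁ o₂ o₃)
  where
  open AbelianGroup F using (_≈_; _∙_; trans; comm)

  γ₂γ₁≈γ₃ : γ₂ ∙ γ₁ ≈ γ₃
  γ₂γ₁≈γ₃ = trans (comm γ₂ γ₁) γ₁γ₂≈γ₃
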